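{- Let $u\le w$ in $\mathbb{P}^*$ under generalized factor order, let $\eta$ be an embedding of $u$ into $w$, let $m_i=w(i)-\eta(i)$, and let $M_\eta=\{1^{m_1},2^{m_2},\dots\}$ (the multiset containing $i$ with multiplicity $m_i$). (a) If $u$ is not flat, a sequence is the chain id of a maximal chain of $[u,w]$ ending at $\eta$ if and only if it is an admissible permutation of $M_\eta$. (b) If $u$ is flat, a sequence is the chain id of a maximal chain of $[u,w]$ ending at $\eta$ if and only if it is a strongly admissible permutation of $M_\eta$.
   Context: $\mathbb{P}=\{1,2,\dots\}$. Generalized factor order on $\mathbb{P}^*$: $u\le w$ iff for some $i\ge0$, $u(j)\le w(i+j)$ for $1\le j\le|u|$. Basic notions. - A word is flat if all its letters are $1$. - An embedding of $u$ into $w$ is $\eta\in0^*u0^*$ of length $|w|$ with $\eta(k)\le w(k)$ for all $k$. - In an embedding of a word $v$, a letter is reducible if it exceeds $1$, or it is a $1$ that is the first nonzero letter, or $v$ is not flat and it is a $1$ that is the last nonzero letter. Reducing subtracts $1$. Chain ids. A maximal chain $w=v_0\to\dots\to v_n=u$ has chain id $l_1\cdots l_n$, where $\eta_{v_0}=w$ and $\eta_{v_k}$ (an embedding of $v_k$ into $w$) is obtained from $\eta_{v_{k-1}}$ by reducing the reducible letter at position $l_k$. The chain ends at $\eta_{v_n}$. Admissibility. Let $f$ and $\ell$ be the positions of the first and last nonzero letters of $\eta$. - A permutation of $M_\eta$ is admissible if the last occurrence of $i$ precedes the last occurrence of $i+1$ for all $1\le i\le f-2$, and the last occurrence of $j$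 precedes the last occurrence of $j-1$ for all $\ell+2\le j\le|w|$. - An admissible permutation is strongly admissible if the last occurrence of $\ell+1$ appears before either one value from $\{f,\dots,\ell\}$ or two copies of a value from $\{1,\dots,f-1\}$. -}

module Defs where

open import Data.Nat using (ℕ; zero; suc; _+_; _∸_; _≤_; _<_)
open import Data.List using (List; []; _∷_; _++_; length; replicate; take; drop; filter)
open import Data.List.Relation.Unary.All using (All)
open import Data.List.Relation.Binary.Pointwise using (Pointwise)
open import Data.List.Membership.Propositional using (_∈_; _∉_)
open import Data.List.Relation.Binary.Permutation.Propositional using (_↭_)
open import Data.Maybe using (Maybe; just; nothing)
open import Data.Product using (Σ; ∃; ∃-syntax; _×_)
open import Data.Sum using (_⊎_)
open import Relation.Nullary using (¬_)
open import Relation.Binary.PropositionalEquality using (_≡_; _≢_)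
open import Relation.Nullary.Decidable using (¬?)
open import Data.Nat.Properties using (_≟_)

-- Words are lists of naturals; words in ℙ* are those with all letters ≥ 1
-- (the predicate PWord). Embeddings are lists of naturals that may contain 0.
-- Positions are 1-based throughout.

PWord : List ℕ → Set
PWord w = All (λ x → 1 ≤ x) w

GFO : List ℕ → List ℕ → Set
GFO u w = ∃[ i ] Pointwise _≤_ u (take (length u) (drop i w))

Flat : List ℕ → Set
Flat v = All (λ x → x ≡ 1) v

-- Embedding of u into w: η ∈ 0* u 0*, |η| = |w|, η(k) ≤ w(k) for all k
-- (the Pointwise relation forces |η| = |w|).
Embedding : List ℕ → List ℕ → List ℕ → Set
Embedding u w η =
  Σ ℕ λ i → Σ ℕ λ j → (η ≡ replicate i 0 ++ u ++ replicate j 0) × Pointwise _≤_ η w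

-- The word v of which η is an embedding: η with its zeros removed.
strip : List ℕ → List ℕ
strip η = filter (λ x → ¬? (x ≟ 0)) η

at : List ℕ → ℕ → Maybe ℕ
at [] _ = nothing
at (x ∷ xs) zero = nothing
at (x ∷ xs) (suc zero) = just x
at (x ∷ xs) (suc (suc n)) = at xs (suc n)

decAt : ℕ → List ℕ → List ℕ
decAt _ [] = []
decAt zero (x ∷ xs) = x ∷ xs
decAt (suc zero) (x ∷ xs) = (x ∸ 1) ∷ xs
decAt (suc (suc n)) (x ∷ xs) = x ∷ decAt (suc n) xs

IsFirstNZ : List ℕ → ℕ → Set
IsFirstNZ η f = Σ (List ℕ) λ xs → Σ ℕ λ y → Σ (List ℕ) λ ys →
  (η ≡ xs ++ y ∷ ys) × All (λ x → x ≡ 0) xs × y ≢ 0 × f ≡ suc (length xs)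

IsLastNZ : List ℕ → ℕ → Set
IsLastNZ η ℓ = Σ (List ℕ) λ xs → Σ ℕ λ y → Σ (List ℕ) λ ys →
  (η ≡ xs ++ y ∷ ys) × All (λ x → x ≡ 0) ys × y ≢ 0 × ℓ ≡ suc (length xs)

Reducible : List ℕ → ℕ → Set
Reducible η p = Σ ℕ λ x → (at η p ≡ just x) ×
  (  2 ≤ x
  ⊎ (x ≡ 1 × IsFirstNZ η p)
  ⊎ (x ≡ 1 × ¬ Flat (strip η) × IsLastNZ η p))

data Reduces : List ℕ → List ℕ → List ℕ → Set where
  done : ∀ {η} → Reduces η [] η
  step : ∀ {η l ls η'} → Reducible η l → Reduces (decAt l η) ls η' → Reduces η (l ∷ ls) η'

-- s is the chain id of a maximal chain of [u,w] ending at η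
-- (η_{v_0} = w, each step reduces a reducible letter, η_{v_n} = η).
IsChainIdEndingAt : List ℕ → List ℕ → List ℕ → Set
IsChainIdEndingAt w η s = Reduces w s η

-- M_η = {1^{m_1}, 2^{m_2}, ...}, m_i = w(i) - η(i), as a list (multiset up to ↭)
multiset : ℕ → List ℕ → List ℕ → List ℕ
multiset k (x ∷ xs) (y ∷ ys) = replicate (x ∸ y) k ++ multiset (suc k) xs ys
multiset k _ _ = []

M : List ℕ → List ℕ → List ℕ
M w η = multiset 1 w η

LastPrecedes : ℕ → ℕ → List ℕ → Set
LastPrecedes a b s = Σ (List ℕ) λ xs → Σ (List ℕ) λ ys →
  (s ≡ xs ++ b ∷ ys) × a ∈ xs × a ∉ ys

Admissible : List ℕ → List ℕ → List ℕ → Set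
Admissible w η s = (s ↭ M w η) ×
  (∀ f ℓ → IsFirstNZ η f → IsLastNZ η ℓ →
     (∀ i → 1 ≤ i → i + 2 ≤ f → LastPrecedes i (suc i) s) ×
     (∀ j → ℓ + 2 ≤ j → j ≤ length w → LastPrecedes j (j ∸ 1) s))

-- strongly admissible: admissible, and the last occurrence of ℓ+1 appears before
-- either one value from {f,…,ℓ} or two copies of a value from {1,…,f-1}
-- (vacuous when ℓ+1 does not occur).
StronglyAdmissible : List ℕ → List ℕ → List ℕ → Set
StronglyAdmissible w η s = Admissible w η s ×
  (∀ f ℓ → IsFirstNZ η f → IsLastNZ η ℓ →
     ∀ xs ys → s ≡ xs ++ suc ℓ ∷ ys → suc ℓ ∉ ys →
       (Σ ℕ λ c → c ∈ ys × f ≤ c × c ≤ ℓ)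
     ⊎ (Σ ℕ λ c → 1 ≤ c × c < f × Σ (List ℕ) λ as → Σ (List ℕ) λ bs → Σ (List ℕ) λ cs →
          ys ≡ as ++ c ∷ bs ++ c ∷ cs))

{-# OPTIONS --safe #-}
-- Reducing the letter at position l lowers it by one, so a chain from w down to η reduces each
-- position p exactly w(p) − η(p) times: its chain id is a permutation of M_η. Every intermediate
-- word is an embedding, so its support is an interval containing [f, ℓ]; hence a position
-- i < f − 1 must be emptied before i + 1 is, and symmetrically on the right — this is
-- admissibility. Conversely an admissible permutation can be followed letter by letter: the
-- next letter is either at least 2, or a 1 that the ordering conditions force to be the first
-- or the last nonzero letter. A last 1 is reducible only while some letter ≥ 2 remains; for
-- non-flat u this is automatic since the word dominates η, and for flat u the critical moment
-- is the last reduction at ℓ + 1, where strong admissibility supplies exactly such a letter.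
module Submission where

open import Defs
open import Data.Nat
open import Data.Nat.Properties
open import Data.List using (List; []; _∷_; _++_; length; replicate)
open import Data.List.Properties using (++-assoc; ∷-injectiveʳ; length-++; length-replicate)
open import Data.List.Relation.Unary.All using (All; []; _∷_)
open import Data.List.Relation.Unary.All.Properties using (replicate⁺)
open import Data.List.Relation.Unary.Any using (here; there)
open import Data.List.Relation.Binary.Pointwise using (Pointwise; []; _∷_)
open import Data.List.Relation.Binary.Pointwise.Properties using (Pointwise-length)
open import Data.List.Membership.Propositional using (_∈_; _∉_)
open import Data.List.Membership.Propositional.Properties
  using (∈-++⁺ˡ; ∈-++⁺ʳ; ∈-++⁻; ∈-∃++; ∉[])
open import Data.List.Membership.DecPropositional _≟_ using (_∈?_)
open import Data.List.Relation.Binary.Permutation.Propositional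
  using (_↭_; ↭-sym; ↭-trans; ↭-refl; prep)
open import Data.List.Relation.Binary.Permutation.Propositional.Properties
  using (shift; drop-∷; drop-mid; ∈-resp-↭; ↭-empty-inv; ++⁺ˡ)
open import Data.Maybe using (just)
open import Data.Product using (Σ; _×_; _,_; proj₁; proj₂)
open import Data.Sum using (_⊎_; inj₁; inj₂; map₂)
open import Data.Empty using (⊥-elim)
open import Relation.Nullary using (¬_; yes; no; contradiction)
open import Relation.Binary.PropositionalEquality
open import Relation.Binary.Definitions using (tri<; tri≈; tri>)
open import Function.Bundles using (_⇔_; mk⇔)

≤∸1⇒< : ∀ {m n} → 1 ≤ n → m ≤ n ∸ 1 → m < n
≤∸1⇒< {n = suc n} _ m≤n = s≤s m≤n

<∸1⇒1+< : ∀ {m n} → m < n ∸ 1 → suc m < n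
<∸1⇒1+< {n = suc n} m<n = s≤s m<n

≢[]⇒1≤length : ∀ {A : Set} (xs : List A) → xs ≢ [] → 1 ≤ length xs
≢[]⇒1≤length []      xs≢[] = ⊥-elim (xs≢[] refl)
≢[]⇒1≤length (_ ∷ _) _     = s≤s z≤n

-- Positions are 1-based as in Defs; outside 1 … length e the letter is read as 0.
letter : List ℕ → ℕ → ℕ
letter []       _             = 0
letter (x ∷ xs) zero          = 0
letter (x ∷ xs) (suc zero)    = x
letter (x ∷ xs) (suc (suc n)) = letter xs (suc n)

letter-zero : ∀ e → letter e 0 ≡ 0
letter-zero []      = refl
letter-zero (_ ∷ _) = refl

at⇒letter : ∀ e p {x} → at e p ≡ just x → letter e p ≡ x × 1 ≤ p × p ≤ length e
at⇒letter (y ∷ e) (suc zero)    refl = refl , s≤s z≤n , s≤s z≤n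
at⇒letter (y ∷ e) (suc (suc p)) at≡ with at⇒letter e (suc p) at≡
... | eq , _ , p≤ = eq , s≤s z≤n , s≤s p≤

letter⇒at : ∀ e p → 1 ≤ p → p ≤ length e → at e p ≡ just (letter e p)
letter⇒at (x ∷ e) (suc zero)    _ _         = refl
letter⇒at (x ∷ e) (suc (suc p)) _ (s≤s p≤) = letter⇒at e (suc p) (s≤s z≤n) p≤

letter>0⇒inRange : ∀ e p → 0 < letter e p → 1 ≤ p × p ≤ length e
letter>0⇒inRange (x ∷ e) (suc zero)    _   = s≤s z≤n , s≤s z≤n
letter>0⇒inRange (x ∷ e) (suc (suc p)) pos = s≤s z≤n , s≤s (proj₂ (letter>0⇒inRange e (suc p) pos))

letter-ext : ∀ a b → length a ≡ length b → (∀ p → letter a p ≡ letter b p) → a ≡ b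
letter-ext []      []      _   _  = refl
letter-ext (x ∷ a) (y ∷ b) len eq = cong₂ _∷_ (eq 1) (letter-ext a b (suc-injective len) eq′)
  where
  eq′ : ∀ p → letter a p ≡ letter b p
  eq′ zero    = trans (letter-zero a) (sym (letter-zero b))
  eq′ (suc p) = eq (suc (suc p))

All⇒letter : ∀ {P : ℕ → Set} xs → All P xs → ∀ q → 1 ≤ q → q ≤ length xs → P (letter xs q)
All⇒letter (x ∷ xs) (px ∷ _)  (suc zero)    _ _        = px
All⇒letter (x ∷ xs) (_ ∷ pxs) (suc (suc q)) _ (s≤s q≤) = All⇒letter xs pxs (suc q) (s≤s z≤n) q≤

All≡0⇒letter≡0 : ∀ {ys} → All (_≡ 0) ys → ∀ q → letter ys q ≡ 0
All≡0⇒letter≡0 []         _             = refl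
All≡0⇒letter≡0 (_ ∷ _)    zero          = refl
All≡0⇒letter≡0 (y≡0 ∷ _)  (suc zero)    = y≡0
All≡0⇒letter≡0 (_ ∷ ys≡0) (suc (suc q)) = All≡0⇒letter≡0 ys≡0 (suc q)

letter≡0⇒All≡0 : ∀ xs → (∀ q → 1 ≤ q → letter xs q ≡ 0) → All (_≡ 0) xs
letter≡0⇒All≡0 []       _      = []
letter≡0⇒All≡0 (x ∷ xs) zeroes =
  zeroes 1 (s≤s z≤n) ∷ letter≡0⇒All≡0 xs (λ { (suc q) _ → zeroes (suc (suc q)) (s≤s z≤n) })

Pointwise⇒letter-≤ : ∀ {a b} → Pointwise _≤_ a b → ∀ p → letter a p ≤ letter b p
Pointwise⇒letter-≤ []           _             = z≤n
Pointwise⇒letter-≤ (_ ∷ _)      zero          = z≤n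
Pointwise⇒letter-≤ (x≤y ∷ _)    (suc zero)    = x≤y
Pointwise⇒letter-≤ (_ ∷ xs≤ys)  (suc (suc p)) = Pointwise⇒letter-≤ xs≤ys (suc p)

letter-++ˡ : ∀ a b q → q ≤ length a → letter (a ++ b) q ≡ letter a q
letter-++ˡ a       b zero          _        = trans (letter-zero (a ++ b)) (sym (letter-zero a))
letter-++ˡ (x ∷ a) b (suc zero)    _        = refl
letter-++ˡ (x ∷ a) b (suc (suc q)) (s≤s q≤) = letter-++ˡ a b (suc q) q≤

letter-++ʳ : ∀ xs b q → letter (xs ++ b) (suc (length xs + q)) ≡ letter b (suc q)
letter-++ʳ []       b q = refl
letter-++ʳ (x ∷ xs) b q = letter-++ʳ xs b q

letter-middle : ∀ xs y ys → letter (xs ++ y ∷ ys) (suc (length xs)) ≡ y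
letter-middle []       y ys = refl
letter-middle (x ∷ xs) y ys = letter-middle xs y ys

letter-before : ∀ xs r → All (_≡ 0) xs → ∀ q → q ≤ length xs → letter (xs ++ r) q ≡ 0
letter-before xs       r _          zero          _        = letter-zero (xs ++ r)
letter-before (x ∷ xs) r (x≡0 ∷ _)  (suc zero)    _        = x≡0
letter-before (x ∷ xs) r (_ ∷ xs≡0) (suc (suc q)) (s≤s q≤) = letter-before xs r xs≡0 (suc q) q≤

letter-beyond : ∀ xs {zs} → All (_≡ 0) zs → ∀ q → length xs < q → letter (xs ++ zs) q ≡ 0
letter-beyond []       zs≡0 (suc q)       _        = All≡0⇒letter≡0 zs≡0 (suc q)
letter-beyond (x ∷ xs) zs≡0 (suc (suc q)) (s≤s lt) = letter-beyond xs zs≡0 (suc q) lt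

length-decAt : ∀ l e → length (decAt l e) ≡ length e
length-decAt _             []      = refl
length-decAt zero          (x ∷ e) = refl
length-decAt (suc zero)    (x ∷ e) = refl
length-decAt (suc (suc l)) (x ∷ e) = cong suc (length-decAt (suc l) e)

letter-decAt-≡ : ∀ l e → letter (decAt l e) l ≡ letter e l ∸ 1
letter-decAt-≡ zero          []      = refl
letter-decAt-≡ zero          (x ∷ e) = refl
letter-decAt-≡ (suc l)       []      = refl
letter-decAt-≡ (suc zero)    (x ∷ e) = refl
letter-decAt-≡ (suc (suc l)) (x ∷ e) = letter-decAt-≡ (suc l) e

letter-decAt-≢ : ∀ l e p → p ≢ l → letter (decAt l e) p ≡ letter e p
letter-decAt-≢ _             []      p             _   = refl
letter-decAt-≢ zero          (x ∷ e) p             _   = refl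
letter-decAt-≢ (suc zero)    (x ∷ e) zero          _   = refl
letter-decAt-≢ (suc zero)    (x ∷ e) (suc zero)    1≢1 = ⊥-elim (1≢1 refl)
letter-decAt-≢ (suc zero)    (x ∷ e) (suc (suc p)) _   = refl
letter-decAt-≢ (suc (suc l)) (x ∷ e) zero          _   = refl
letter-decAt-≢ (suc (suc l)) (x ∷ e) (suc zero)    _   = refl
letter-decAt-≢ (suc (suc l)) (x ∷ e) (suc (suc p)) p≢l =
  letter-decAt-≢ (suc l) e (suc p) (λ eq → p≢l (cong suc eq))

letter-decAt-≤ : ∀ l e p → letter (decAt l e) p ≤ letter e p
letter-decAt-≤ l e p with p ≟ l
... | yes refl rewrite letter-decAt-≡ l e = m∸n≤m (letter e l) 1
... | no p≢l   rewrite letter-decAt-≢ l e p p≢l = ≤-refl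

Flat-strip⇒letter≤1 : ∀ e → Flat (strip e) → ∀ c → letter e c ≤ 1
Flat-strip⇒letter≤1 []          _           _             = z≤n
Flat-strip⇒letter≤1 (x ∷ e)     _           zero          = z≤n
Flat-strip⇒letter≤1 (zero ∷ e)  _           (suc zero)    = z≤n
Flat-strip⇒letter≤1 (zero ∷ e)  flat        (suc (suc c)) = Flat-strip⇒letter≤1 e flat (suc c)
Flat-strip⇒letter≤1 (suc x ∷ e) (x≡1 ∷ _)   (suc zero)    = ≤-reflexive x≡1
Flat-strip⇒letter≤1 (suc x ∷ e) (_ ∷ flat)  (suc (suc c)) = Flat-strip⇒letter≤1 e flat (suc c)

letter≥2⇒¬Flat-strip : ∀ e {c} → 2 ≤ letter e c → ¬ Flat (strip e)
letter≥2⇒¬Flat-strip e {c} 2≤ flat = <⇒≱ 2≤ (Flat-strip⇒letter≤1 e flat c)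

letter≥2⊎Flat-strip : ∀ e → (Σ ℕ λ c → 2 ≤ letter e c) ⊎ Flat (strip e)
letter≥2⊎Flat-strip []               = inj₂ []
letter≥2⊎Flat-strip (x ∷ e) with letter≥2⊎Flat-strip e | x ≟ 0 | x ≟ 1
... | inj₁ (zero , 2≤) | _ | _ = contradiction (subst (2 ≤_) (letter-zero e) 2≤) λ ()
... | inj₁ (suc c , 2≤) | _ | _ = inj₁ (suc (suc c) , 2≤)
... | inj₂ flat | yes refl | _ = inj₂ flat
... | inj₂ flat | _ | yes refl = inj₂ (refl ∷ flat)
... | inj₂ _ | no x≢0 | no x≢1 = inj₁ (1 , ≤∧≢⇒< (n≢0⇒n>0 x≢0) (≢-sym x≢1))

¬Flat⇒letter≥2 : ∀ u → All (1 ≤_) u → ¬ Flat u →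
  Σ ℕ λ q → 1 ≤ q × q ≤ length u × 2 ≤ letter u q
¬Flat⇒letter≥2 []       _          ¬flat = ⊥-elim (¬flat [])
¬Flat⇒letter≥2 (x ∷ u) (1≤x ∷ pos) ¬flat with x ≟ 1
... | no x≢1 = 1 , s≤s z≤n , s≤s z≤n , ≤∧≢⇒< 1≤x (≢-sym x≢1)
... | yes refl with ¬Flat⇒letter≥2 u pos (λ flat → ¬flat (refl ∷ flat))
...   | suc q , _ , q≤ , 2≤ = suc (suc q) , s≤s z≤n , s≤s q≤ , 2≤

ReducibleLetter : List ℕ → ℕ → Set
ReducibleLetter e l =
    2 ≤ letter e l
  ⊎ (letter e l ≡ 1 × IsFirstNZ e l)
  ⊎ (letter e l ≡ 1 × ¬ Flat (strip e) × IsLastNZ e l)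

Reducible⇒ : ∀ {e l} → Reducible e l → 1 ≤ l × l ≤ length e × ReducibleLetter e l
Reducible⇒ {e} {l} (_ , at≡ , cases) with at⇒letter e l at≡
... | refl , 1≤l , l≤ = 1≤l , l≤ , cases

Reducible⇐ : ∀ {e l} → 1 ≤ l → l ≤ length e → ReducibleLetter e l → Reducible e l
Reducible⇐ {e} {l} 1≤l l≤ cases = letter e l , letter⇒at e l 1≤l l≤ , cases

Reducible⇒positive : ∀ {e l} → Reducible e l → 1 ≤ letter e l
Reducible⇒positive r with Reducible⇒ r
... | _ , _ , inj₁ 2≤                = ≤-trans (s≤s z≤n) 2≤
... | _ , _ , inj₂ (inj₁ (e≡1 , _)) = ≤-reflexive (sym e≡1)
... | _ , _ , inj₂ (inj₂ (e≡1 , _)) = ≤-reflexive (sym e≡1)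

∈-replicate⁻ : ∀ n {k m : ℕ} → m ∈ replicate n k → m ≡ k × 0 < n
∈-replicate⁻ (suc n) (here m≡k) = m≡k , s≤s z≤n
∈-replicate⁻ (suc n) (there m∈) = proj₁ (∈-replicate⁻ n m∈) , s≤s z≤n

∈-replicate⁺ : ∀ {n} (k : ℕ) → 0 < n → k ∈ replicate n k
∈-replicate⁺ {suc n} k _ = here refl

∈-multiset⁻ : ∀ k e η {m} → m ∈ multiset k e η →
  Σ ℕ λ p → m ≡ k + p × letter η (suc p) < letter e (suc p)
∈-multiset⁻ k (x ∷ e) (y ∷ η) m∈ with ∈-++⁻ (replicate (x ∸ y) k) m∈
... | inj₁ m∈k with ∈-replicate⁻ (x ∸ y) m∈k
...   | refl , 0<x∸y = 0 , sym (+-identityʳ k) , m∸n≢0⇒n<m (≢-sym (<⇒≢ 0<x∸y))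
∈-multiset⁻ k (x ∷ e) (y ∷ η) m∈ | inj₂ m∈rest with ∈-multiset⁻ (suc k) e η m∈rest
... | p , refl , lt = suc p , sym (+-suc k p) , lt

∈-multiset⁺ : ∀ k e η p → length e ≡ length η → letter η (suc p) < letter e (suc p) →
  k + p ∈ multiset k e η
∈-multiset⁺ k (x ∷ e) (y ∷ η) zero    _   lt rewrite +-identityʳ k =
  ∈-++⁺ˡ (∈-replicate⁺ k (m<n⇒0<n∸m lt))
∈-multiset⁺ k (x ∷ e) (y ∷ η) (suc p) len lt rewrite +-suc k p =
  ∈-++⁺ʳ (replicate (x ∸ y) k) (∈-multiset⁺ (suc k) e η p (suc-injective len) lt)

multiset-decAt : ∀ k e η p → length e ≡ length η → letter η (suc p) < letter e (suc p) →
  multiset k e η ↭ k + p ∷ multiset k (decAt (suc p) e) η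
multiset-decAt k (suc x ∷ e) (y ∷ η) zero _ (s≤s y≤x)
  rewrite +-identityʳ k | +-∸-assoc 1 y≤x = ↭-refl
multiset-decAt k (x ∷ e) (y ∷ η) (suc p) len lt rewrite +-suc k p =
  ↭-trans (++⁺ˡ (replicate (x ∸ y) k) (multiset-decAt (suc k) e η p (suc-injective len) lt))
          (shift (suc k + p) (replicate (x ∸ y) k) _)

multiset-self : ∀ k e → multiset k e e ≡ []
multiset-self k []      = refl
multiset-self k (x ∷ e) rewrite n∸n≡0 x = multiset-self (suc k) e

∈M⁻ : ∀ e η {m} → m ∈ M e η → letter η m < letter e m × 1 ≤ m × m ≤ length e
∈M⁻ e η m∈ with ∈-multiset⁻ 1 e η m∈
... | p , refl , lt = lt , s≤s z≤n , proj₂ (letter>0⇒inRange e (suc p) (≤-<-trans z≤n lt))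

∈M⁺ : ∀ e η m → length e ≡ length η → letter η m < letter e m → m ∈ M e η
∈M⁺ e η zero    _   lt = contradiction (subst (letter η 0 <_) (letter-zero e) lt) n≮0
∈M⁺ e η (suc p) len lt = ∈-multiset⁺ 1 e η p len lt

M-decAt : ∀ e η m → length e ≡ length η → letter η m < letter e m →
  M e η ↭ m ∷ M (decAt m e) η
M-decAt e η zero    _   lt = contradiction (subst (letter η 0 <_) (letter-zero e) lt) n≮0
M-decAt e η (suc p) len lt = multiset-decAt 1 e η p len lt

↭M-∷⁻ : ∀ e η {l s} → length e ≡ length η → l ∷ s ↭ M e η →
  letter η l < letter e l × s ↭ M (decAt l e) η
↭M-∷⁻ e η {l} len perm = lt , drop-∷ (↭-trans perm (M-decAt e η l len lt))
  where
  lt : letter η l < letter e l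
  lt = proj₁ (∈M⁻ e η (∈-resp-↭ perm (here refl)))

OccursTwice : ℕ → List ℕ → Set
OccursTwice c s =
  Σ (List ℕ) λ as → Σ (List ℕ) λ bs → Σ (List ℕ) λ cs → s ≡ as ++ c ∷ bs ++ c ∷ cs

∈⇒occursTwice : ∀ {c : ℕ} as t → c ∈ as ++ t → OccursTwice c (as ++ c ∷ t)
∈⇒occursTwice {c} as t c∈ with ∈-++⁻ as c∈
... | inj₁ c∈as with ∈-∃++ c∈as
...   | a₁ , a₂ , refl = a₁ , a₂ , t , ++-assoc a₁ (c ∷ a₂) (c ∷ t)
∈⇒occursTwice {c} as t c∈ | inj₂ c∈t with ∈-∃++ c∈t
...   | bs , cs , refl = as , bs , cs , refl

occursTwice⇒η+1<e : ∀ e η {c s} → length e ≡ length η → s ↭ M e η → OccursTwice c s →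
  suc (letter η c) < letter e c
occursTwice⇒η+1<e e η {c} len perm (as , bs , cs , refl) =
  <∸1⇒1+< (subst (letter η c <_) (letter-decAt-≡ c e) lt′)
  where
  lt : letter η c < letter e c
  lt = proj₁ (∈M⁻ e η (∈-resp-↭ perm (∈-++⁺ʳ as (here refl))))
  perm′ : as ++ bs ++ c ∷ cs ↭ M (decAt c e) η
  perm′ = drop-mid as [] (↭-trans perm (M-decAt e η c len lt))
  lt′ : letter η c < letter (decAt c e) c
  lt′ = proj₁ (∈M⁻ (decAt c e) η (∈-resp-↭ perm′ (∈-++⁺ʳ as (∈-++⁺ʳ bs (here refl)))))

η+1<e⇒occursTwice : ∀ e η {c s} → length e ≡ length η → suc (letter η c) < letter e c →
  s ↭ M e η → OccursTwice c s
η+1<e⇒occursTwice e η {c} {s} len lt perm = split (∈-∃++ (∈-resp-↭ (↭-sym perm′) (here refl)))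
  where
  e′ = decAt c e
  lt′ : letter η c < letter e′ c
  lt′ = subst (letter η c <_) (sym (letter-decAt-≡ c e)) (∸-monoˡ-≤ 1 lt)
  perm′ : s ↭ c ∷ M e′ η
  perm′ = ↭-trans perm (M-decAt e η c len (<-trans (n<1+n _) lt))
  split : (Σ (List ℕ) λ as → Σ (List ℕ) λ t → s ≡ as ++ c ∷ t) → OccursTwice c s
  split (as , t , refl) = ∈⇒occursTwice as t
    (∈-resp-↭ (↭-sym (drop-mid as [] perm′)) (∈M⁺ e′ η c (trans (length-decAt c e) len) lt′))

IsFirstNZ⇒ : ∀ e p → IsFirstNZ e p → letter e p ≢ 0 × (∀ q → q < p → letter e q ≡ 0)
IsFirstNZ⇒ e p (xs , y , ys , refl , xs≡0 , y≢0 , refl) =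
  (λ eq → y≢0 (trans (sym (letter-middle xs y ys)) eq)) ,
  λ q q<p → letter-before xs (y ∷ ys) xs≡0 q (≤-pred q<p)

IsFirstNZ⇐ : ∀ e p → 1 ≤ p → p ≤ length e → letter e p ≢ 0 →
  (∀ q → 1 ≤ q → q < p → letter e q ≡ 0) → IsFirstNZ e p
IsFirstNZ⇐ (x ∷ e) (suc zero)    _ _          x≢0 _      = [] , x , e , refl , [] , x≢0 , refl
IsFirstNZ⇐ (x ∷ e) (suc (suc p)) _ (s≤s p≤) y≢0 before
  with IsFirstNZ⇐ e (suc p) (s≤s z≤n) p≤ y≢0
         (λ { (suc q) _ q<p → before (suc (suc q)) (s≤s z≤n) (s≤s q<p) })
... | xs , y , ys , eq , xs≡0 , y≢0′ , len =
  x ∷ xs , y , ys , cong (x ∷_) eq , before 1 (s≤s z≤n) (s≤s (s≤s z≤n)) ∷ xs≡0 , y≢0′ ,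
  cong suc len

IsLastNZ⇒ : ∀ e p → IsLastNZ e p → letter e p ≢ 0 × (∀ q → p < q → letter e q ≡ 0)
IsLastNZ⇒ e p (xs , y , ys , refl , ys≡0 , y≢0 , refl) =
  (λ eq → y≢0 (trans (sym (letter-middle xs y ys)) eq)) , after xs
  where
  after : ∀ as → ∀ q → suc (length as) < q → letter (as ++ y ∷ ys) q ≡ 0
  after []       (suc zero)    (s≤s ())
  after []       (suc (suc q)) _        = All≡0⇒letter≡0 ys≡0 (suc q)
  after (a ∷ as) (suc (suc q)) (s≤s lt) = after as (suc q) lt

IsLastNZ⇐ : ∀ e p → 1 ≤ p → p ≤ length e → letter e p ≢ 0 →
  (∀ q → p < q → letter e q ≡ 0) → IsLastNZ e p
IsLastNZ⇐ (x ∷ e) (suc zero)    _ _          x≢0 after =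
  [] , x , e , refl , letter≡0⇒All≡0 e (λ { (suc q) _ → after (suc (suc q)) (s≤s (s≤s z≤n)) }) ,
  x≢0 , refl
IsLastNZ⇐ (x ∷ e) (suc (suc p)) _ (s≤s p≤) y≢0 after
  with IsLastNZ⇐ e (suc p) (s≤s z≤n) p≤ y≢0
         (λ { (suc q) (s≤s p<q) → after (suc (suc q)) (s≤s (s≤s p<q)) })
... | xs , y , ys , eq , ys≡0 , y≢0′ , len =
  x ∷ xs , y , ys , cong (x ∷_) eq , ys≡0 , y≢0′ , cong suc len

IsFirstNZ-unique : ∀ {e p q} → IsFirstNZ e p → IsFirstNZ e q → p ≡ q
IsFirstNZ-unique {e} {p} {q} first-p first-q with <-cmp p q
... | tri< p<q _ _ = ⊥-elim (proj₁ (IsFirstNZ⇒ e p first-p) (proj₂ (IsFirstNZ⇒ e q first-q) p p<q))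
... | tri≈ _ p≡q _ = p≡q
... | tri> _ _ q<p = ⊥-elim (proj₁ (IsFirstNZ⇒ e q first-q) (proj₂ (IsFirstNZ⇒ e p first-p) q q<p))

IsLastNZ-unique : ∀ {e p q} → IsLastNZ e p → IsLastNZ e q → p ≡ q
IsLastNZ-unique {e} {p} {q} last-p last-q with <-cmp p q
... | tri< p<q _ _ = ⊥-elim (proj₁ (IsLastNZ⇒ e q last-q) (proj₂ (IsLastNZ⇒ e p last-p) q p<q))
... | tri≈ _ p≡q _ = p≡q
... | tri> _ _ q<p = ⊥-elim (proj₁ (IsLastNZ⇒ e p last-p) (proj₂ (IsLastNZ⇒ e q last-q) p q<p))

LastOccurrence : ℕ → List ℕ → Set
LastOccurrence b s = Σ (List ℕ) λ xs → Σ (List ℕ) λ ys → s ≡ xs ++ b ∷ ys × b ∉ ys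

lastOccurrence : ∀ {b} s → b ∈ s → LastOccurrence b s
lastOccurrence {b} (x ∷ s) b∈ with b ∈? s
... | yes b∈s with lastOccurrence s b∈s
...   | xs , ys , eq , b∉ys = x ∷ xs , ys , cong (x ∷_) eq , b∉ys
lastOccurrence (x ∷ s) (here refl)  | no b∉s = [] , s , refl , b∉s
lastOccurrence (x ∷ s) (there b∈s) | no b∉s = ⊥-elim (b∉s b∈s)

LastPrecedes-∷⇒∈ : ∀ {a b l s} → LastPrecedes a b (l ∷ s) → b ∈ s
LastPrecedes-∷⇒∈ ([]     , _ , _    , () , _)
LastPrecedes-∷⇒∈ (_ ∷ xs , _ , refl , _  , _) = ∈-++⁺ʳ xs (here refl)

LastPrecedes-∷⁺ : ∀ {a b} l {s} → LastPrecedes a b s → LastPrecedes a b (l ∷ s)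
LastPrecedes-∷⁺ l (xs , ys , eq , a∈xs , a∉ys) = l ∷ xs , ys , cong (l ∷_) eq , there a∈xs , a∉ys

∈-++-∷⁻ : ∀ {a b : ℕ} xs {ys} → a ∈ xs ++ b ∷ ys → a ≢ b → a ∉ ys → a ∈ xs
∈-++-∷⁻ xs a∈ a≢b a∉ys with ∈-++⁻ xs a∈
... | inj₁ a∈xs         = a∈xs
... | inj₂ (here a≡b)   = ⊥-elim (a≢b a≡b)
... | inj₂ (there a∈ys) = ⊥-elim (a∉ys a∈ys)

LastPrecedes-∷⁻ : ∀ {a b l s} → a ∈ s → a ≢ b → LastPrecedes a b (l ∷ s) → LastPrecedes a b s
LastPrecedes-∷⁻ _ _ ([] , _ , _ , () , _)
LastPrecedes-∷⁻ a∈s a≢b (_ ∷ xs , ys , refl , _ , a∉ys) =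
  xs , ys , refl , ∈-++-∷⁻ xs a∈s a≢b a∉ys , a∉ys

lastPrecedes-∷ : ∀ {a b s} → a ∉ s → LastOccurrence b s → LastPrecedes a b (a ∷ s)
lastPrecedes-∷ {a} a∉s (xs , ys , eq , _) =
  a ∷ xs , ys , cong (a ∷_) eq , here refl ,
  λ a∈ys → a∉s (subst (a ∈_) (sym eq) (∈-++⁺ʳ xs (there a∈ys)))

module Support (η : List ℕ) (f ℓ : ℕ) (f≤ℓ : f ≤ ℓ)
  (η-left   : ∀ p → p < f → letter η p ≡ 0)
  (η-right  : ∀ p → ℓ < p → letter η p ≡ 0)
  (η-inside : ∀ p → f ≤ p → p ≤ ℓ → 1 ≤ letter η p) where

  Above : List ℕ → Set
  Above e = length e ≡ length η × (∀ p → letter η p ≤ letter e p)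

  Above-decAt⁻ : ∀ l e → Above (decAt l e) → Above e
  Above-decAt⁻ l e (len , ≤e) =
    trans (sym (length-decAt l e)) len , λ p → ≤-trans (≤e p) (letter-decAt-≤ l e p)

  Above-decAt⁺ : ∀ l e → Above e → letter η l < letter e l → Above (decAt l e)
  Above-decAt⁺ l e (len , ≤e) lt = trans (length-decAt l e) len , ≤e′
    where
    ≤e′ : ∀ p → letter η p ≤ letter (decAt l e) p
    ≤e′ p with p ≟ l
    ... | yes refl rewrite letter-decAt-≡ p e = ∸-monoˡ-≤ 1 lt
    ... | no p≢l   rewrite letter-decAt-≢ l e p p≢l = ≤e p

  e-f>0 : ∀ e → Above e → 0 < letter e f
  e-f>0 _ (_ , ≤e) = ≤-trans (η-inside f ≤-refl f≤ℓ) (≤e f)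

  Reduces⇒Above : ∀ {e s} → Reduces e s η → Above e
  Reduces⇒Above done                             = refl , λ _ → ≤-refl
  Reduces⇒Above (step {η = e} {l = l} _ red) = Above-decAt⁻ l e (Reduces⇒Above red)

  Reducible⇒η<e : ∀ e l → Reducible e l → Above (decAt l e) → letter η l < letter e l
  Reducible⇒η<e e l r (_ , ≤e′) =
    ≤∸1⇒< (Reducible⇒positive r) (subst (letter η l ≤_) (letter-decAt-≡ l e) (≤e′ l))

  Reduces⇒↭M : ∀ {e s} → Reduces e s η → s ↭ M e η
  Reduces⇒↭M done = subst ([] ↭_) (sym (multiset-self 1 η)) ↭-refl
  Reduces⇒↭M (step {η = e} {l = l} r red) =
    ↭-trans (prep l (Reduces⇒↭M red))
            (↭-sym (M-decAt e η l (proj₁ (Reduces⇒Above (step r red)))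
                                  (Reducible⇒η<e e l r (Reduces⇒Above red))))

  LeftContiguous : List ℕ → Set
  LeftContiguous e = ∀ p → 1 ≤ p → p < f → 0 < letter e p → 0 < letter e (suc p)

  LeftOrdered : List ℕ → Set
  LeftOrdered s = ∀ i → 1 ≤ i → suc (suc i) ≤ f → i ∈ s → LastPrecedes i (suc i) s

  LeftContiguous-decAt : ∀ e l → LeftContiguous e → Reducible e l → Above (decAt l e) →
    LeftContiguous (decAt l e)
  LeftContiguous-decAt e l con r ab′ p 1≤p p<f pos′ with suc p ≟ l
  ... | no p+1≢l rewrite letter-decAt-≢ l e (suc p) p+1≢l =
    con p 1≤p p<f (≤-trans pos′ (letter-decAt-≤ l e p))
  ... | yes refl with suc p ≟ f | proj₂ (proj₂ (Reducible⇒ r))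
  ...   | yes refl  | _ = ≤-trans (η-inside (suc p) ≤-refl f≤ℓ) (proj₂ ab′ (suc p))
  ...   | no _      | inj₁ 2≤ rewrite letter-decAt-≡ (suc p) e = ∸-monoˡ-≤ 1 2≤
  ...   | no _      | inj₂ (inj₁ (_ , first)) =
    contradiction (proj₂ (IsFirstNZ⇒ e (suc p) first) p ≤-refl)
                  (≢-sym (<⇒≢ (≤-trans pos′ (letter-decAt-≤ (suc p) e p))))
  ...   | no p+1≢f | inj₂ (inj₂ (_ , _ , last)) =
    contradiction (proj₂ (IsLastNZ⇒ e (suc p) last) f (≤∧≢⇒< p<f p+1≢f))
                  (≢-sym (<⇒≢ (e-f>0 e (Above-decAt⁻ (suc p) e ab′))))

  Reduces⇒LeftOrdered : ∀ {e s} → LeftContiguous e → Reduces e s η → LeftOrdered s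
  Reduces⇒LeftOrdered con done i _ _ ()
  Reduces⇒LeftOrdered {e} con (step {l = l} {ls = s} r red) i 1≤i i+2≤f i∈ with i ∈? s
  ... | yes i∈s =
    LastPrecedes-∷⁺ l
      (Reduces⇒LeftOrdered (LeftContiguous-decAt e l con r (Reduces⇒Above red)) red i 1≤i i+2≤f i∈s)
  ... | no i∉s with i∈
  ...   | there i∈s = ⊥-elim (i∉s i∈s)
  ...   | here refl = lastPrecedes-∷ i∉s (lastOccurrence s i+1∈s)
    where
    lt : letter η (suc i) < letter (decAt i e) (suc i)
    lt rewrite η-left (suc i) i+2≤f | letter-decAt-≢ i e (suc i) 1+n≢n =
      con i 1≤i (≤-trans (n≤1+n (suc i)) i+2≤f) (Reducible⇒positive r)
    i+1∈s : suc i ∈ s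
    i+1∈s = ∈-resp-↭ (↭-sym (Reduces⇒↭M red))
                     (∈M⁺ (decAt i e) η (suc i) (proj₁ (Reduces⇒Above red)) lt)

  RightContiguous : List ℕ → Set
  RightContiguous e = ∀ q → ℓ ≤ q → 0 < letter e (suc q) → 0 < letter e q

  RightOrdered : List ℕ → Set
  RightOrdered s = ∀ j → suc (suc ℓ) ≤ j → j ∈ s → LastPrecedes j (j ∸ 1) s

  RightContiguous-decAt : ∀ e l → RightContiguous e → Reducible e l → Above (decAt l e) →
    RightContiguous (decAt l e)
  RightContiguous-decAt e l con r ab′ q ℓ≤q pos′ with q ≟ l
  ... | no q≢l rewrite letter-decAt-≢ l e q q≢l =
    con q ℓ≤q (≤-trans pos′ (letter-decAt-≤ l e (suc q)))
  ... | yes refl with q ≟ ℓ | proj₂ (proj₂ (Reducible⇒ r))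
  ...   | yes refl | _ = ≤-trans (η-inside q f≤ℓ ≤-refl) (proj₂ ab′ q)
  ...   | no _     | inj₁ 2≤ rewrite letter-decAt-≡ q e = ∸-monoˡ-≤ 1 2≤
  ...   | no q≢ℓ   | inj₂ (inj₁ (_ , first)) =
    contradiction (proj₂ (IsFirstNZ⇒ e q first) f (≤-<-trans f≤ℓ (≤∧≢⇒< ℓ≤q (≢-sym q≢ℓ))))
                  (≢-sym (<⇒≢ (e-f>0 e (Above-decAt⁻ q e ab′))))
  ...   | no _     | inj₂ (inj₂ (_ , _ , last)) =
    contradiction (proj₂ (IsLastNZ⇒ e q last) (suc q) ≤-refl)
                  (≢-sym (<⇒≢ (≤-trans pos′ (letter-decAt-≤ q e (suc q)))))

  Reduces⇒RightOrdered : ∀ {e s} → RightContiguous e → Reduces e s η → RightOrdered s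
  Reduces⇒RightOrdered con done _ _ ()
  Reduces⇒RightOrdered con (step _ _) zero () _
  Reduces⇒RightOrdered {e} con (step {l = l} {ls = s} r red) (suc q) ℓ+2≤ j∈ with suc q ∈? s
  ... | yes j∈s =
    LastPrecedes-∷⁺ l
      (Reduces⇒RightOrdered (RightContiguous-decAt e l con r (Reduces⇒Above red)) red (suc q) ℓ+2≤ j∈s)
  ... | no j∉s with j∈
  ...   | there j∈s = ⊥-elim (j∉s j∈s)
  ...   | here refl = lastPrecedes-∷ j∉s (lastOccurrence s q∈s)
    where
    lt : letter η q < letter (decAt (suc q) e) q
    lt rewrite η-right q (≤-pred ℓ+2≤) | letter-decAt-≢ (suc q) e q (≢-sym 1+n≢n) =
      con q (≤-trans (n≤1+n ℓ) (≤-pred ℓ+2≤)) (Reducible⇒positive r)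
    q∈s : q ∈ s
    q∈s = ∈-resp-↭ (↭-sym (Reduces⇒↭M red))
                   (∈M⁺ (decAt (suc q) e) η q (proj₁ (Reduces⇒Above red)) lt)

  FlatInside : Set
  FlatInside = ∀ p → f ≤ p → p ≤ ℓ → letter η p ≡ 1

  StrongWitness : List ℕ → Set
  StrongWitness ys =
      (Σ ℕ λ c → c ∈ ys × f ≤ c × c ≤ ℓ)
    ⊎ (Σ ℕ λ c → 1 ≤ c × c < f × OccursTwice c ys)

  Strong : List ℕ → Set
  Strong s = ∀ xs ys → s ≡ xs ++ suc ℓ ∷ ys → suc ℓ ∉ ys → StrongWitness ys

  -- At the last reduction of position ℓ + 1 that letter is a 1 which must be the last nonzero
  -- letter of a non-flat word; the letter ≥ 2 it leaves behind is still to be reduced.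
  lastReduction⇒StrongWitness : FlatInside → ∀ {e ys} → Reducible e (suc ℓ) →
    Above (decAt (suc ℓ) e) → ys ↭ M (decAt (suc ℓ) e) η → suc ℓ ∉ ys → StrongWitness ys
  lastReduction⇒StrongWitness flat {e} {ys} r ab′ perm ℓ+1∉ys =
    cases (proj₂ (proj₂ (Reducible⇒ r)))
    where
    e′ = decAt (suc ℓ) e
    remains : ∀ c → letter η c < letter e′ c → c ∈ ys
    remains c lt = ∈-resp-↭ (↭-sym perm) (∈M⁺ e′ η c (proj₁ ab′) lt)
    letter-e′ : ∀ c → c ≢ suc ℓ → letter e′ c ≡ letter e c
    letter-e′ = letter-decAt-≢ (suc ℓ) e
    inside : ∀ c → 2 ≤ letter e c → IsLastNZ e (suc ℓ) → letter e (suc ℓ) ≡ 1 → f ≤ c →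
      StrongWitness ys
    inside c 2≤ last e-ℓ+1≡1 f≤c with <-cmp c (suc ℓ)
    ... | tri< c<ℓ+1 _ _ = inj₁ (c , remains c lt , f≤c , ≤-pred c<ℓ+1)
      where
      lt : letter η c < letter e′ c
      lt rewrite flat c f≤c (≤-pred c<ℓ+1) | letter-e′ c (<⇒≢ c<ℓ+1) = 2≤
    ... | tri≈ _ refl _ = contradiction e-ℓ+1≡1 (≢-sym (<⇒≢ 2≤))
    ... | tri> _ _ c>ℓ+1 =
      contradiction (proj₂ (IsLastNZ⇒ e (suc ℓ) last) c c>ℓ+1) (≢-sym (<⇒≢ (≤-trans (s≤s z≤n) 2≤)))
    cases : ReducibleLetter e (suc ℓ) → StrongWitness ys
    cases (inj₁ 2≤) = ⊥-elim (ℓ+1∉ys (remains (suc ℓ) lt))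
      where
      lt : letter η (suc ℓ) < letter e′ (suc ℓ)
      lt rewrite η-right (suc ℓ) ≤-refl | letter-decAt-≡ (suc ℓ) e = ∸-monoˡ-≤ 1 2≤
    cases (inj₂ (inj₁ (_ , first))) =
      contradiction (proj₂ (IsFirstNZ⇒ e (suc ℓ) first) f (s≤s f≤ℓ))
                    (≢-sym (<⇒≢ (e-f>0 e (Above-decAt⁻ (suc ℓ) e ab′))))
    cases (inj₂ (inj₂ (e-ℓ+1≡1 , ¬flat , last))) with letter≥2⊎Flat-strip e
    ... | inj₂ flat-e = ⊥-elim (¬flat flat-e)
    ... | inj₁ (c , 2≤) with <-cmp c f
    ...   | tri≈ _ c≡f _ = inside c 2≤ last e-ℓ+1≡1 (≤-reflexive (sym c≡f))
    ...   | tri> _ _ f<c = inside c 2≤ last e-ℓ+1≡1 (<⇒≤ f<c)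
    ...   | tri< c<f _ _ =
      inj₂ (c , proj₁ (letter>0⇒inRange e c (≤-trans (s≤s z≤n) 2≤)) , c<f ,
            η+1<e⇒occursTwice e′ η (proj₁ ab′) lt perm)
      where
      lt : suc (letter η c) < letter e′ c
      lt rewrite η-left c c<f | letter-e′ c (<⇒≢ (<-≤-trans c<f (≤-trans f≤ℓ (n≤1+n ℓ)))) = 2≤

  Reduces⇒Strong : FlatInside → ∀ {e s} → Reduces e s η → Strong s
  Reduces⇒Strong _    done         []       _  ()   _
  Reduces⇒Strong _    done         (_ ∷ _)  _  ()   _
  Reduces⇒Strong flat (step r red) []       ys refl ℓ+1∉ys =
    lastReduction⇒StrongWitness flat r (Reduces⇒Above red) (Reduces⇒↭M red) ℓ+1∉ys
  Reduces⇒Strong flat (step r red) (_ ∷ xs) ys eq   ℓ+1∉ys =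
    Reduces⇒Strong flat red xs ys (∷-injectiveʳ eq) ℓ+1∉ys

  LeftOrdered-∷⁻ : ∀ {l s} → LeftOrdered (l ∷ s) → LeftOrdered s
  LeftOrdered-∷⁻ lo i 1≤i i+2≤f i∈s = LastPrecedes-∷⁻ i∈s (≢-sym 1+n≢n) (lo i 1≤i i+2≤f (there i∈s))

  RightOrdered-∷⁻ : ∀ {l s} → RightOrdered (l ∷ s) → RightOrdered s
  RightOrdered-∷⁻ ro zero    () _
  RightOrdered-∷⁻ ro (suc q) ℓ+2≤ j∈s = LastPrecedes-∷⁻ j∈s 1+n≢n (ro (suc q) ℓ+2≤ (there j∈s))

  Strong-∷⁻ : ∀ {l s} → Strong (l ∷ s) → Strong s
  Strong-∷⁻ {l} st xs ys eq = st (l ∷ xs) ys (cong (l ∷_) eq)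

  LeftOrdered⇒∈ : ∀ {l s} → LeftOrdered (l ∷ s) → ∀ {q r} → 1 ≤ q → q <′ r → r < f →
    q ∈ l ∷ s → r ∈ s
  LeftOrdered⇒∈ lo 1≤q ≤′-refl r<f q∈ = LastPrecedes-∷⇒∈ (lo _ 1≤q r<f q∈)
  LeftOrdered⇒∈ lo 1≤q (≤′-step q<′r) r<f q∈ =
    LastPrecedes-∷⇒∈ (lo _ (≤-trans 1≤q (<⇒≤ (<′⇒< q<′r))) r<f
      (there (LeftOrdered⇒∈ lo 1≤q q<′r (≤-trans (n≤1+n _) r<f) q∈)))

  RightOrdered⇒∈ : ∀ {l s} → RightOrdered (l ∷ s) → ∀ {t r} → suc ℓ ≤ t → t <′ r → r ∈ l ∷ s → t ∈ s
  RightOrdered⇒∈ ro ℓ<t ≤′-refl r∈ = LastPrecedes-∷⇒∈ (ro _ (s≤s ℓ<t) r∈)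
  RightOrdered⇒∈ ro ℓ<t (≤′-step t<′r) r∈ =
    RightOrdered⇒∈ ro ℓ<t t<′r
      (there (LastPrecedes-∷⇒∈ (ro _ (s≤s (≤-trans ℓ<t (<⇒≤ (<′⇒< t<′r)))) r∈)))

  Above∧M≡[]⇒≡η : ∀ e → Above e → M e η ≡ [] → e ≡ η
  Above∧M≡[]⇒≡η e (len , ≤e) M≡[] = letter-ext e η len λ p →
    ≤-antisym (≮⇒≥ (λ lt → ∉[] (subst (p ∈_) M≡[] (∈M⁺ e η p len lt)))) (≤e p)

  NonFlat : Set
  NonFlat = Σ ℕ λ p → 2 ≤ letter η p

  -- The next letter l is a 1 of e, hence lies outside [f, ℓ]; the ordering conditions force it
  -- to be the first or the last nonzero letter.
  module UnitHead {e l s} (ab : Above e) (perm : l ∷ s ↭ M e η)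
    (lo : LeftOrdered (l ∷ s)) (ro : RightOrdered (l ∷ s)) (nf : NonFlat ⊎ Strong (l ∷ s))
    (e-l≡1 : letter e l ≡ 1) where

    l-reduced : letter η l < letter e l
    l-reduced = proj₁ (↭M-∷⁻ e η (proj₁ ab) perm)

    perm′ : s ↭ M (decAt l e) η
    perm′ = proj₂ (↭M-∷⁻ e η (proj₁ ab) perm)

    1≤l×l≤|e| : 1 ≤ l × l ≤ length e
    1≤l×l≤|e| = proj₂ (∈M⁻ e η (∈-resp-↭ perm (here refl)))

    e-l≢0 : letter e l ≢ 0
    e-l≢0 eq = 1+n≢0 (trans (sym e-l≡1) eq)

    l∉s : l ∉ s
    l∉s l∈s = n≮0 (subst (letter η l <_) (trans (letter-decAt-≡ l e) (cong (_∸ 1) e-l≡1))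
                         (proj₁ (∈M⁻ (decAt l e) η (∈-resp-↭ perm′ l∈s))))

    η-l≡0 : letter η l ≡ 0
    η-l≡0 = n<1⇒n≡0 (subst (letter η l <_) e-l≡1 l-reduced)

    occurs : ∀ q → 0 < letter e q → letter η q ≡ 0 → q ∈ l ∷ s
    occurs q pos η-q≡0 =
      ∈-resp-↭ (↭-sym perm) (∈M⁺ e η q (proj₁ ab) (subst (_< letter e q) (sym η-q≡0) pos))

    left-first : l < f → IsFirstNZ e l
    left-first l<f = IsFirstNZ⇐ e l (proj₁ 1≤l×l≤|e|) (proj₂ 1≤l×l≤|e|) e-l≢0 before
      where
      before : ∀ q → 1 ≤ q → q < l → letter e q ≡ 0
      before q 1≤q q<l with letter e q in e-q
      ... | zero  = refl
      ... | suc _ = ⊥-elim (l∉s (LeftOrdered⇒∈ lo 1≤q (<⇒<′ q<l) l<f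
                      (occurs q (subst (0 <_) (sym e-q) (s≤s z≤n)) (η-left q (<-trans q<l l<f)))))

    right-last : ℓ < l → IsLastNZ e l
    right-last ℓ<l = IsLastNZ⇐ e l (proj₁ 1≤l×l≤|e|) (proj₂ 1≤l×l≤|e|) e-l≢0 after
      where
      after : ∀ q → l < q → letter e q ≡ 0
      after q l<q with letter e q in e-q
      ... | zero  = refl
      ... | suc _ = ⊥-elim (l∉s (RightOrdered⇒∈ ro ℓ<l (<⇒<′ l<q)
                      (occurs q (subst (0 <_) (sym e-q) (s≤s z≤n)) (η-right q (<-trans ℓ<l l<q)))))

    witness⇒letter≥2 : ∀ xs ys → l ∷ s ≡ xs ++ suc ℓ ∷ ys → StrongWitness ys →
      Σ ℕ λ c → 2 ≤ letter e c
    witness⇒letter≥2 xs ys eq (inj₁ (c , c∈ys , f≤c , c≤ℓ)) =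
      c , ≤-trans (s≤s (η-inside c f≤c c≤ℓ))
                  (proj₁ (∈M⁻ e η (∈-resp-↭ perm (subst (c ∈_) (sym eq) (∈-++⁺ʳ xs (there c∈ys))))))
    witness⇒letter≥2 xs ys eq (inj₂ (c , _ , _ , as , bs , cs , refl)) =
      c , ≤-trans (s≤s (s≤s z≤n))
                  (occursTwice⇒η+1<e e η (proj₁ ab) perm
                    (xs ++ suc ℓ ∷ as , bs , cs , trans eq (sym (++-assoc xs (suc ℓ ∷ as) (c ∷ bs ++ c ∷ cs)))))

    right-letter≥2 : ℓ < l → Σ ℕ λ c → 2 ≤ letter e c
    right-letter≥2 ℓ<l = from nf
      where
      from : NonFlat ⊎ Strong (l ∷ s) → Σ ℕ λ c → 2 ≤ letter e c
      from (inj₁ (c , 2≤)) = c , ≤-trans 2≤ (proj₂ ab c)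
      from (inj₂ st) with l ≟ suc ℓ
      ... | yes l≡ℓ+1 = witness⇒letter≥2 [] s eq (st [] s eq (subst (_∉ s) l≡ℓ+1 l∉s))
        where
        eq : l ∷ s ≡ [] ++ suc ℓ ∷ s
        eq = cong (_∷ s) l≡ℓ+1
      ... | no l≢ℓ+1
        with lastOccurrence s (RightOrdered⇒∈ ro ≤-refl (<⇒<′ (≤∧≢⇒< ℓ<l (≢-sym l≢ℓ+1))) (here refl))
      ...   | xs , ys , eq , ℓ+1∉ys =
        witness⇒letter≥2 (l ∷ xs) ys (cong (l ∷_) eq) (st (l ∷ xs) ys (cong (l ∷_) eq) ℓ+1∉ys)

    unit-reducible : ReducibleLetter e l
    unit-reducible with l <? f | ℓ <? l
    ... | yes l<f | _       = inj₂ (inj₁ (e-l≡1 , left-first l<f))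
    ... | no _    | yes ℓ<l =
      inj₂ (inj₂ (e-l≡1 , letter≥2⇒¬Flat-strip e (proj₂ (right-letter≥2 ℓ<l)) , right-last ℓ<l))
    ... | no l≮f  | no ℓ≮l  = contradiction η-l≡0 (≢-sym (<⇒≢ (η-inside l (≮⇒≥ l≮f) (≮⇒≥ ℓ≮l))))

  head-reducible : ∀ {e l s} → Above e → l ∷ s ↭ M e η → LeftOrdered (l ∷ s) → RightOrdered (l ∷ s) →
    NonFlat ⊎ Strong (l ∷ s) → Reducible e l
  head-reducible {e} {l} ab perm lo ro nf with ∈M⁻ e η (∈-resp-↭ perm (here refl)) | 2 ≤? letter e l
  ... | _   , 1≤l , l≤ | yes 2≤ = Reducible⇐ 1≤l l≤ (inj₁ 2≤)
  ... | η<e , 1≤l , l≤ | no 2≰ = Reducible⇐ 1≤l l≤ (UnitHead.unit-reducible ab perm lo ro nf e-l≡1)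
    where
    e-l≡1 : letter e l ≡ 1
    e-l≡1 = ≤-antisym (≤-pred (≰⇒> 2≰)) (≤-trans (s≤s z≤n) η<e)

  Reduces⇐ : ∀ s {e} → Above e → s ↭ M e η → LeftOrdered s → RightOrdered s → NonFlat ⊎ Strong s →
    Reduces e s η
  Reduces⇐ [] {e} ab perm _ _ _ =
    subst (λ e → Reduces e [] η) (sym (Above∧M≡[]⇒≡η e ab (↭-empty-inv (↭-sym perm)))) done
  Reduces⇐ (l ∷ s) {e} ab perm lo ro nf with ↭M-∷⁻ e η (proj₁ ab) perm
  ... | η<e , perm′ = step (head-reducible ab perm lo ro nf)
    (Reduces⇐ s (Above-decAt⁺ l e ab η<e) perm′ (LeftOrdered-∷⁻ lo) (RightOrdered-∷⁻ ro) (map₂ Strong-∷⁻ nf))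

module Embedded (u w : List ℕ) (pu : PWord u) (pw : PWord w) (i j : ℕ) (u≢[] : u ≢ [])
  (η≤w : Pointwise _≤_ (replicate i 0 ++ u ++ replicate j 0) w) where

  η : List ℕ
  η = replicate i 0 ++ u ++ replicate j 0

  f ℓ : ℕ
  f = suc i
  ℓ = i + length u

  f≤ℓ : f ≤ ℓ
  f≤ℓ = subst (_≤ ℓ) (+-comm i 1) (+-monoʳ-≤ i (≢[]⇒1≤length u u≢[]))

  η-at-u : ∀ o → suc o ≤ length u → letter η (suc (i + o)) ≡ letter u (suc o)
  η-at-u o o<|u| = begin
    letter η (suc (i + o))                       ≡⟨ cong (λ n → letter η (suc (n + o))) (sym (length-replicate i)) ⟩
    letter η (suc (length (replicate i 0) + o))  ≡⟨ letter-++ʳ (replicate i 0) (u ++ replicate j 0) o ⟩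
    letter (u ++ replicate j 0) (suc o)          ≡⟨ letter-++ˡ u (replicate j 0) (suc o) o<|u| ⟩
    letter u (suc o)                             ∎
    where open ≡-Reasoning

  η-on-support : ∀ p → f ≤ p → p ≤ ℓ →
    Σ ℕ λ o → suc o ≤ length u × letter η p ≡ letter u (suc o)
  η-on-support p f≤p p≤ℓ with m≤n⇒∃[o]m+o≡n f≤p
  ... | o , refl = o , o<|u| , η-at-u o o<|u|
    where
    o<|u| : suc o ≤ length u
    o<|u| = +-cancelˡ-≤ i (suc o) (length u) (subst (_≤ ℓ) (sym (+-suc i o)) p≤ℓ)

  η-left : ∀ p → p < f → letter η p ≡ 0
  η-left p (s≤s p≤i) =
    letter-before (replicate i 0) (u ++ replicate j 0) (replicate⁺ i refl) p
                  (subst (p ≤_) (sym (length-replicate i)) p≤i)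

  η-right : ∀ p → ℓ < p → letter η p ≡ 0
  η-right p ℓ<p = trans (cong (λ v → letter v p) (sym (++-assoc (replicate i 0) u (replicate j 0))))
    (letter-beyond (replicate i 0 ++ u) (replicate⁺ j refl) p (subst (_< p) (sym |0ⁱu|) ℓ<p))
    where
    |0ⁱu| : length (replicate i 0 ++ u) ≡ ℓ
    |0ⁱu| = trans (length-++ (replicate i 0)) (cong (_+ length u) (length-replicate i))

  η-inside : ∀ p → f ≤ p → p ≤ ℓ → 1 ≤ letter η p
  η-inside p f≤p p≤ℓ with η-on-support p f≤p p≤ℓ
  ... | o , o<|u| , η-p≡u-o = subst (1 ≤_) (sym η-p≡u-o) (All⇒letter u pu (suc o) (s≤s z≤n) o<|u|)

  open Support η f ℓ f≤ℓ η-left η-right η-inside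

  |w|≡|η| : length w ≡ length η
  |w|≡|η| = sym (Pointwise-length η≤w)

  ℓ≤|w| : ℓ ≤ length w
  ℓ≤|w| = subst (ℓ ≤_) (sym |w|≡|η|) (proj₂ (letter>0⇒inRange η ℓ (η-inside ℓ f≤ℓ ≤-refl)))

  f≤|w| : f ≤ length w
  f≤|w| = ≤-trans f≤ℓ ℓ≤|w|

  w-positive : ∀ q → 1 ≤ q → q ≤ length w → 1 ≤ letter w q
  w-positive = All⇒letter w pw

  w-above : Above w
  w-above = |w|≡|η| , Pointwise⇒letter-≤ η≤w

  w-leftContiguous : LeftContiguous w
  w-leftContiguous p _ p<f _ = w-positive (suc p) (s≤s z≤n) (≤-trans p<f f≤|w|)

  w-rightContiguous : RightContiguous w
  w-rightContiguous q ℓ≤q pos =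
    w-positive q (≤-trans (s≤s z≤n) (≤-trans f≤ℓ ℓ≤q))
                 (≤-trans (n≤1+n q) (proj₂ (letter>0⇒inRange w (suc q) pos)))

  η-first : IsFirstNZ η f
  η-first = IsFirstNZ⇐ η f (s≤s z≤n) (subst (f ≤_) |w|≡|η| f≤|w|)
    (≢-sym (<⇒≢ (η-inside f ≤-refl f≤ℓ))) (λ q _ → η-left q)

  η-last : IsLastNZ η ℓ
  η-last = IsLastNZ⇐ η ℓ (≤-trans (s≤s z≤n) f≤ℓ) (subst (ℓ ≤_) |w|≡|η| ℓ≤|w|)
    (≢-sym (<⇒≢ (η-inside ℓ f≤ℓ ≤-refl))) η-right

  unreduced-∈ : ∀ {s} → s ↭ M w η → ∀ a → letter η a ≡ 0 → 1 ≤ a → a ≤ length w → a ∈ s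
  unreduced-∈ perm a η-a≡0 1≤a a≤|w| =
    ∈-resp-↭ (↭-sym perm) (∈M⁺ w η a |w|≡|η| (subst (_< letter w a) (sym η-a≡0) (w-positive a 1≤a a≤|w|)))

  Admissible⇐ : ∀ {s} → s ↭ M w η → LeftOrdered s → RightOrdered s → Admissible w η s
  Admissible⇐ {s} perm lo ro = perm , conditions
    where
    conditions : ∀ f′ ℓ′ → IsFirstNZ η f′ → IsLastNZ η ℓ′ →
        (∀ a → 1 ≤ a → a + 2 ≤ f′ → LastPrecedes a (suc a) s)
      × (∀ b → ℓ′ + 2 ≤ b → b ≤ length w → LastPrecedes b (b ∸ 1) s)
    conditions f′ ℓ′ first last rewrite IsFirstNZ-unique first η-first | IsLastNZ-unique last η-last =
      left , right
      where
      left : ∀ a → 1 ≤ a → a + 2 ≤ f → LastPrecedes a (suc a) s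
      left a 1≤a a+2≤f = lo a 1≤a 2+a≤f (unreduced-∈ perm a (η-left a a<f) 1≤a (≤-trans (<⇒≤ a<f) f≤|w|))
        where
        2+a≤f : suc (suc a) ≤ f
        2+a≤f = subst (_≤ f) (+-comm a 2) a+2≤f
        a<f : a < f
        a<f = ≤-trans (n≤1+n _) 2+a≤f
      right : ∀ b → ℓ + 2 ≤ b → b ≤ length w → LastPrecedes b (b ∸ 1) s
      right b ℓ+2≤b b≤|w| = ro b 2+ℓ≤b (unreduced-∈ perm b (η-right b ℓ<b) (≤-trans (s≤s z≤n) ℓ<b) b≤|w|)
        where
        2+ℓ≤b : suc (suc ℓ) ≤ b
        2+ℓ≤b = subst (_≤ b) (+-comm ℓ 2) ℓ+2≤b
        ℓ<b : ℓ < b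
        ℓ<b = ≤-trans (n≤1+n _) 2+ℓ≤b

  Admissible⇒ : ∀ {s} → Admissible w η s → s ↭ M w η × LeftOrdered s × RightOrdered s
  Admissible⇒ (perm , conditions) =
    perm ,
    (λ a 1≤a a+2≤f _ → proj₁ (conditions f ℓ η-first η-last) a 1≤a (subst (_≤ f) (+-comm 2 a) a+2≤f)) ,
    (λ b ℓ+2≤b b∈s → proj₂ (conditions f ℓ η-first η-last) b (subst (_≤ b) (+-comm 2 ℓ) ℓ+2≤b)
                       (proj₂ (proj₂ (∈M⁻ w η (∈-resp-↭ perm b∈s)))))

  Reduces⇒Admissible : ∀ {s} → Reduces w s η → Admissible w η s
  Reduces⇒Admissible red =
    Admissible⇐ (Reduces⇒↭M red) (Reduces⇒LeftOrdered w-leftContiguous red)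
                (Reduces⇒RightOrdered w-rightContiguous red)

  Admissible⇒Reduces : ∀ {s} → Admissible w η s → NonFlat ⊎ Strong s → Reduces w s η
  Admissible⇒Reduces {s} ad nf with Admissible⇒ ad
  ... | perm , lo , ro = Reduces⇐ s w-above perm lo ro nf

  StronglyAdmissible⇐ : ∀ {s} → Admissible w η s → Strong s → StronglyAdmissible w η s
  StronglyAdmissible⇐ {s} ad st = ad , strong
    where
    strong : ∀ f′ ℓ′ → IsFirstNZ η f′ → IsLastNZ η ℓ′ →
      ∀ xs ys → s ≡ xs ++ suc ℓ′ ∷ ys → suc ℓ′ ∉ ys →
      (Σ ℕ λ c → c ∈ ys × f′ ≤ c × c ≤ ℓ′) ⊎ (Σ ℕ λ c → 1 ≤ c × c < f′ × OccursTwice c ys)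
    strong f′ ℓ′ first last rewrite IsFirstNZ-unique first η-first | IsLastNZ-unique last η-last = st

  nonFlat : ¬ Flat u → NonFlat
  nonFlat ¬flat with ¬Flat⇒letter≥2 u pu ¬flat
  ... | suc o , _ , o<|u| , 2≤ = suc (i + o) , subst (2 ≤_) (sym (η-at-u o o<|u|)) 2≤

  flatInside : Flat u → FlatInside
  flatInside flat p f≤p p≤ℓ with η-on-support p f≤p p≤ℓ
  ... | o , o<|u| , η-p≡u-o = trans η-p≡u-o (All⇒letter u flat (suc o) (s≤s z≤n) o<|u|)

  nonflat-case : ¬ Flat u → ∀ s → Reduces w s η ⇔ Admissible w η s
  nonflat-case ¬flat s = mk⇔ Reduces⇒Admissible (λ ad → Admissible⇒Reduces ad (inj₁ (nonFlat ¬flat)))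

  flat-case : Flat u → ∀ s → Reduces w s η ⇔ StronglyAdmissible w η s
  flat-case flat s = mk⇔
    (λ red → StronglyAdmissible⇐ (Reduces⇒Admissible red) (Reduces⇒Strong (flatInside flat) red))
    (λ (ad , st) → Admissible⇒Reduces ad (inj₂ (st f ℓ η-first η-last)))

proposition3p5 : (u w : List ℕ) → PWord u → PWord w → GFO u w →
    (η : List ℕ) → Embedding u w η →
    (¬ Flat u → ∀ s → IsChainIdEndingAt w η s ⇔ Admissible w η s) ×
    (Flat u → u ≢ [] → ∀ s → IsChainIdEndingAt w η s ⇔ StronglyAdmissible w η s)
proposition3p5 u w pu pw _ η (i , j , refl , η≤w) =
  (λ ¬flat → Embedded.nonflat-case u w pu pw i j (λ u≡[] → ¬flat (subst Flat (sym u≡[]) [])) η≤w ¬flat)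
  ,
  (λ flat u≢[] → Embedded.flat-case u w pu pw i j u≢[] η≤w flat)
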